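{- Let $G$ be a mixed graph, $G^*$ its associated digraph, and $\ell\ge 1$. Then the sequence mixed graph $S^{\ell}(G)$ can be obtained from the $\ell$-iterated line digraph $L^{\ell}(G^*)$ by identifying each vertex $\mathbf{u}=u_0u_1\dots u_{\ell-1}u_\ell$ with its conjugate $\overline{\mathbf{u}}=u_\ell u_{\ell-1}\dots u_1u_0$ whenever the latter is also a vertex of $L^{\ell}(G^*)$, and replacing the resulting digons (pairs of opposite arcs) by edges.
   Context: A mixed graph $G$ has (undirected) edges and (directed) arcs, with no loops; its associated digraph $G^*$ is obtained by replacing each edge by two opposite arcs (a digon). A walk of length $\ell$ is a sequence $u_0u_1\dots u_\ell$ such that each $(u_{i-1},u_i)$ is an edge or an arc from $u_{i-1}$ to $u_i$; it is undirected if it uses only edges. The conjugate of $u_0\dots u_\ell$ is $u_\ell\dots u_0$. For a digraph $D$, the $\ell$-iterated line digraph $L^{\ell}(D)$ has as vertices the walks $u_0u_1\dots u_\ell$ of length $\ell$ in $D$, with an arc from $u_0u_1\dots u_\ell$ to each $u_1u_2\dots u_\ell u_{\ell+1}$ such that $(u_\ell,u_{\ell+1})$ is an arc of $D$. The sequence mixed graph $S^{\ell}(G)$: its vertices are the walks of length $\ell$ of $G$, where a walk and its conjugate are regarded as the same vertex if and only if the walk is undirected. For distinct vertices $\mathbf{x},\mathbf{y}$ of $S^{\ell}(G)$, there is an adjacency from $\mathbf{x}$ to $\mathbf{y}$ if there is a walk $u_0u_1\dots u_{\ell+1}$ in $G$ with $u_0\dots u_\ell$ representing $\mathbf{x}$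 and $u_1\dots u_{\ell+1}$ representing $\mathbf{y}$; this adjacency is an edge if such a walk uses only edges of $G$, and an arc from $\mathbf{x}$ to $\mathbf{y}$ otherwise. Loops are not considered. -}

module Defs where

open import Data.Nat using (ℕ; zero; suc)
open import Data.Vec using (Vec; []; _∷_; reverse; init; tail; last)
open import Data.Product using (Σ; Σ-syntax; _×_; proj₁)
open import Data.Sum using (_⊎_)
open import Data.Unit using (⊤)
open import Relation.Nullary using (¬_)
open import Relation.Binary.PropositionalEquality using (_≡_)

-- Between two vertices there is at most one of: an edge, an arc u→v,
-- an arc v→u (arcs never coincide with edges, no pair of opposite arcs;
-- a digon in a mixed graph is an edge).

record MixedGraph : Set₁ where
  field
    V          : Set
    Edge       : V → V → Set
    Arc        : V → V → Set
    edge-sym   : ∀ {u v} → Edge u v → Edge v u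
    edge-noloop : ∀ {u} → ¬ Edge u u
    arc-noloop : ∀ {u} → ¬ Arc u u
    arc-not-edge : ∀ {u v} → Arc u v → ¬ Edge u v
    arc-asym   : ∀ {u v} → Arc u v → ¬ Arc v u

module _ (G : MixedGraph) where
  open MixedGraph G

  -- arcs of the associated digraph G* (each edge becomes a digon)
  Arc* : V → V → Set
  Arc* u v = Edge u v ⊎ Arc u v

  IsWalk : (V → V → Set) → ∀ {n} → Vec V (suc n) → Set
  IsWalk R (x ∷ [])     = ⊤
  IsWalk R (x ∷ y ∷ xs) = R x y × IsWalk R (y ∷ xs)

  Walk : ℕ → Set
  Walk ℓ = Σ[ xs ∈ Vec V (suc ℓ) ] IsWalk Arc* xs

  seq : ∀ {ℓ} → Walk ℓ → Vec V (suc ℓ)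
  seq = proj₁

  Undirected : ∀ {n} → Vec V (suc n) → Set
  Undirected = IsWalk Edge

  -- The ℓ-iterated line digraph L^ℓ(G*): vertices Walk ℓ, arc from
  -- u₀…u_ℓ to u₁…u_ℓu_{ℓ+1} with (u_ℓ,u_{ℓ+1}) an arc of G*.
  LArc : ∀ {ℓ} → Walk ℓ → Walk ℓ → Set
  LArc x y = (tail (seq x) ≡ init (seq y)) × Arc* (last (seq x)) (last (seq y))

  -- The mixed graph Q^ℓ obtained from L^ℓ(G*) by identifying each vertex
  -- with its conjugate whenever the conjugate is also a vertex, and
  -- replacing digons by edges (loops discarded, multiple arcs merged).
  -- Presented as a mixed graph on the setoid (Walk ℓ , _≈Q_).

  _≈Q_ : ∀ {ℓ} → Walk ℓ → Walk ℓ → Set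
  x ≈Q y = (seq x ≡ seq y) ⊎ (seq y ≡ reverse (seq x))

  QAdj : ∀ {ℓ} → Walk ℓ → Walk ℓ → Set
  QAdj {ℓ} x y = Σ[ x′ ∈ Walk ℓ ] Σ[ y′ ∈ Walk ℓ ] (x′ ≈Q x × y′ ≈Q y × LArc x′ y′)

  QEdge : ∀ {ℓ} → Walk ℓ → Walk ℓ → Set
  QEdge x y = ¬ (x ≈Q y) × QAdj x y × QAdj y x

  QArc : ∀ {ℓ} → Walk ℓ → Walk ℓ → Set
  QArc x y = ¬ (x ≈Q y) × QAdj x y × ¬ QAdj y x

  -- The sequence mixed graph S^ℓ(G), as a mixed graph on the setoid
  -- (Walk ℓ , _≈S_): a walk and its conjugate are the same vertex iff
  -- the walk is undirected.

  _≈S_ : ∀ {ℓ} → Vec V (suc ℓ) → Vec V (suc ℓ) → Set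
  xs ≈S ys = (xs ≡ ys) ⊎ (Undirected xs × ys ≡ reverse xs)

  SAdjVia : (V → V → Set) → ∀ {ℓ} → Walk ℓ → Walk ℓ → Set
  SAdjVia R {ℓ} x y = Σ[ ws ∈ Vec V (suc (suc ℓ)) ]
    (IsWalk R ws × init ws ≈S seq x × tail ws ≈S seq y)

  SEdge : ∀ {ℓ} → Walk ℓ → Walk ℓ → Set
  SEdge x y = ¬ (seq x ≈S seq y) × SAdjVia Edge x y

  SArc : ∀ {ℓ} → Walk ℓ → Walk ℓ → Set
  SArc x y = ¬ (seq x ≈S seq y) × SAdjVia Arc* x y × ¬ SAdjVia Edge x y

-- A vertex of L^ℓ(G*) is a walk of G, and its conjugate is again a walk exactly when each
-- step can be traversed both ways; since G has no digons of arcs, that means the walk is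
-- undirected, so the identifications of L^ℓ(G*) and of S^ℓ(G) coincide.  An arc between
-- two classes is a walk of length ℓ+1 whose two ends represent them.  If the classes are
-- adjacent both ways, comparing the two (ℓ+1)-walks shows that one of them is undirected:
-- either the second is the first shifted (so the first has period two and every step is a
-- digon), or the first walk's two ℓ-subwalks are both undirected, or one of them is and the
-- other walk retraces the last step.  So the digons of the quotient are exactly the edges
-- of S^ℓ(G).
module Submission where

open import Defs
open import Data.Nat using (ℕ; zero; suc; _≤_)
open import Data.Product using (_×_; _,_)
open import Data.Sum using (inj₁; inj₂)
open import Data.Unit using (tt)
open import Data.Empty using (⊥-elim)
open import Data.Vec using (Vec; []; _∷_; reverse; init; tail; last; head; _∷ʳ_)
open import Data.Vec.Properties
  using (reverse-∷; reverse-involutive; reverse-reverse; init-reverse; last-reverse; ∷-injectiveˡ; ∷-injectiveʳ)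
open import Function.Base using (flip; _∘_)
open import Function.Bundles using (_⇔_; mk⇔; Equivalence)
open import Relation.Binary.PropositionalEquality
  using (_≡_; refl; sym; trans; cong; subst; subst₂; module ≡-Reasoning)

module _ (G : MixedGraph) where
  open MixedGraph G

  private
    variable
      n ℓ : ℕ
      u v : V
      R S T : V → V → Set

  IsWalk-map : (∀ {u v} → R u v → S u v) →
               (xs : Vec V (suc n)) → IsWalk G R xs → IsWalk G S xs
  IsWalk-map f (x ∷ [])     tt      = tt
  IsWalk-map f (x ∷ y ∷ xs) (r , w) = f r , IsWalk-map f (y ∷ xs) w

  IsWalk-zipWith : (∀ {u v} → R u v → S u v → T u v) →
                   (xs : Vec V (suc n)) → IsWalk G R xs → IsWalk G S xs → IsWalk G T xs
  IsWalk-zipWith f (x ∷ [])     tt      tt        = tt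
  IsWalk-zipWith f (x ∷ y ∷ xs) (r , w) (s , w′) = f r s , IsWalk-zipWith f (y ∷ xs) w w′

  IsWalk-∷ʳ : (xs : Vec V (suc n)) (y : V) → IsWalk G R xs → R (last xs) y → IsWalk G R (xs ∷ʳ y)
  IsWalk-∷ʳ (x ∷ [])      y tt      r′ = r′ , tt
  IsWalk-∷ʳ (x ∷ x′ ∷ xs) y (r , w) r′ = r , IsWalk-∷ʳ (x′ ∷ xs) y w r′

  IsWalk-reverse : (xs : Vec V (suc n)) → IsWalk G (flip R) xs → IsWalk G R (reverse xs)
  IsWalk-reverse (x ∷ [])     tt = tt
  IsWalk-reverse {R = R} (x ∷ y ∷ ys) (r , w) =
    subst (IsWalk G R) (sym (reverse-∷ x (y ∷ ys)))
      (IsWalk-∷ʳ (reverse (y ∷ ys)) x (IsWalk-reverse (y ∷ ys) w)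
        (subst (flip R x) (sym (last-reverse (y ∷ ys))) r))

  IsWalk-reverse⁻ : (xs : Vec V (suc n)) → IsWalk G R (reverse xs) → IsWalk G (flip R) xs
  IsWalk-reverse⁻ {R = R} xs w =
    subst (IsWalk G (flip R)) (reverse-involutive xs) (IsWalk-reverse (reverse xs) w)

  IsWalk-init : (xs : Vec V (suc (suc n))) → IsWalk G R xs → IsWalk G R (init xs)
  IsWalk-init (x ∷ y ∷ [])     _       = tt
  IsWalk-init (x ∷ y ∷ z ∷ xs) (r , w) = r , IsWalk-init (y ∷ z ∷ xs) w

  IsWalk-tail : (xs : Vec V (suc (suc n))) → IsWalk G R xs → IsWalk G R (tail xs)
  IsWalk-tail (x ∷ y ∷ xs) (_ , w) = w

  IsWalk-lastStep : (xs : Vec V (suc (suc n))) → IsWalk G R xs → R (last (init xs)) (last xs)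
  IsWalk-lastStep (x ∷ y ∷ [])     (r , _) = r
  IsWalk-lastStep (x ∷ y ∷ z ∷ xs) (_ , w) = IsWalk-lastStep (y ∷ z ∷ xs) w

  IsWalk-fromInit : (xs : Vec V (suc (suc n))) →
                    IsWalk G R (init xs) → R (last (init xs)) (last xs) → IsWalk G R xs
  IsWalk-fromInit (x ∷ y ∷ [])     _       r′ = r′ , tt
  IsWalk-fromInit (x ∷ y ∷ z ∷ xs) (r , w) r′ = r , IsWalk-fromInit (y ∷ z ∷ xs) w r′

  IsWalk-fromInitTail : (xs : Vec V (suc (suc (suc n)))) →
                        IsWalk G R (init xs) → IsWalk G R (tail xs) → IsWalk G R xs
  IsWalk-fromInitTail (x ∷ y ∷ xs) (r , _) w = r , w

  digon⇒edge : Arc* G u v → Arc* G v u → Edge u v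
  digon⇒edge (inj₁ e) _        = e
  digon⇒edge (inj₂ a) (inj₁ e) = ⊥-elim (arc-not-edge a (edge-sym e))
  digon⇒edge (inj₂ a) (inj₂ b) = ⊥-elim (arc-asym a b)

  Undirected-reverse : (xs : Vec V (suc n)) → Undirected G xs → Undirected G (reverse xs)
  Undirected-reverse xs u = IsWalk-reverse xs (IsWalk-map {S = flip Edge} edge-sym xs u)

  Undirected-conjugate : {xs ys : Vec V (suc n)} → ys ≡ reverse xs → Undirected G xs → Undirected G ys
  Undirected-conjugate {xs = xs} refl u = Undirected-reverse xs u

  reversible⇒undirected : (xs : Vec V (suc n)) →
                          IsWalk G (Arc* G) xs → IsWalk G (Arc* G) (reverse xs) → Undirected G xs
  reversible⇒undirected xs w w′ = IsWalk-zipWith digon⇒edge xs w (IsWalk-reverse⁻ xs w′)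

  -- A walk u₀u₁…u_{n+2} of period two: every step is followed by its reverse.
  periodic⇒undirected : (ws : Vec V (suc (suc (suc n)))) → IsWalk G (Arc* G) ws →
                        tail (tail ws) ≡ init (init ws) → Undirected G ws
  periodic⇒undirected {zero} (a ∷ b ∷ c ∷ []) (ab , bc , tt) c≡a =
    digon⇒edge ab (subst (Arc* G b) (∷-injectiveˡ c≡a) bc) ,
    digon⇒edge bc (subst (flip (Arc* G) b) (sym (∷-injectiveˡ c≡a)) ab) , tt
  periodic⇒undirected {suc n} (a ∷ b ∷ c ∷ d ∷ ws) (_ , w) eq
    with periodic⇒undirected (b ∷ c ∷ d ∷ ws) w (∷-injectiveʳ eq)
  ... | bc , u = edge-sym (subst (Edge b) (∷-injectiveˡ eq) bc) , bc , u

  -- Writing ws = u₀ … u_{n+2}, the equations force z₀ = u₁ = u_{n+2} and z₁ = u_{n+1}, so the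
  -- first step of zs retraces the last step of ws.
  retraced⇒undirected : (ws zs : Vec V (suc (suc (suc n)))) →
                        IsWalk G (Arc* G) ws → IsWalk G (Arc* G) zs → Undirected G (init ws) →
                        tail zs ≡ reverse (init ws) → init zs ≡ tail ws → Undirected G ws
  retraced⇒undirected ws@(_ ∷ w₁ ∷ _ ∷ _) (z₀ ∷ z₁ ∷ zs) w (back , _) u tail≡ init≡ =
    IsWalk-fromInit ws u (digon⇒edge (IsWalk-lastStep ws w) (subst₂ (Arc* G) z₀≡ z₁≡ back))
    where
    open ≡-Reasoning
    z₀≡ : z₀ ≡ last ws
    z₀≡ = begin
      z₀                                   ≡⟨ ∷-injectiveˡ init≡ ⟩
      w₁                                   ≡⟨ last-reverse (tail (init ws)) ⟨
      last (reverse (tail (init ws)))      ≡⟨ cong last (init-reverse (init ws)) ⟨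
      last (init (reverse (init ws)))      ≡⟨ cong (λ vs → last (init vs)) tail≡ ⟨
      last (init (z₁ ∷ zs))                ≡⟨ cong last init≡ ⟩
      last ws                              ∎
    z₁≡ : z₁ ≡ last (init ws)
    z₁≡ = begin
      z₁                                   ≡⟨ cong head tail≡ ⟩
      head (reverse (init ws))             ≡⟨ last-reverse (reverse (init ws)) ⟨
      last (reverse (reverse (init ws)))   ≡⟨ cong last (reverse-involutive (init ws)) ⟩
      last (init ws)                       ∎

  ≈S-sym : {xs ys : Vec V (suc n)} → _≈S_ G xs ys → _≈S_ G ys xs
  ≈S-sym (inj₁ xs≡ys) = inj₁ (sym xs≡ys)
  ≈S-sym {xs = xs} (inj₂ (u , refl)) =
    inj₂ (Undirected-reverse xs u , sym (reverse-involutive xs))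

  ≈S-trans : {xs ys zs : Vec V (suc n)} → _≈S_ G xs ys → _≈S_ G ys zs → _≈S_ G xs zs
  ≈S-trans (inj₁ refl)       q                  = q
  ≈S-trans (inj₂ p)          (inj₁ refl)        = inj₂ p
  ≈S-trans {xs = xs} (inj₂ (_ , refl)) (inj₂ (_ , refl)) = inj₁ (sym (reverse-involutive xs))

  reverse-≈S : (xs : Vec V (suc n)) → Undirected G xs → _≈S_ G (reverse xs) xs
  reverse-≈S xs u = inj₂ (Undirected-reverse xs u , sym (reverse-involutive xs))

  ≈Q⇔≈S : (x y : Walk G ℓ) → _≈Q_ G x y ⇔ _≈S_ G (seq G x) (seq G y)
  ≈Q⇔≈S (xs , w) (ys , w′) = mk⇔ to from
    where
    to : _≈Q_ G (xs , w) (ys , w′) → _≈S_ G xs ys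
    to (inj₁ xs≡ys)  = inj₁ xs≡ys
    to (inj₂ ys≡xs⁻) =
      inj₂ (reversible⇒undirected xs w (subst (IsWalk G (Arc* G)) ys≡xs⁻ w′) , ys≡xs⁻)
    from : _≈S_ G xs ys → _≈Q_ G (xs , w) (ys , w′)
    from (inj₁ xs≡ys)       = inj₁ xs≡ys
    from (inj₂ (_ , ys≡xs⁻)) = inj₂ ys≡xs⁻

  ≈Q⇒≈S : (x y : Walk G ℓ) → _≈Q_ G x y → _≈S_ G (seq G x) (seq G y)
  ≈Q⇒≈S x y = Equivalence.to (≈Q⇔≈S x y)

  ≈S⇒≈Q : (x y : Walk G ℓ) → _≈S_ G (seq G x) (seq G y) → _≈Q_ G x y
  ≈S⇒≈Q x y = Equivalence.from (≈Q⇔≈S x y)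

  QAdj⇒SAdj : (x y : Walk G (suc ℓ)) → QAdj G x y → SAdjVia G (Arc* G) x y
  QAdj⇒SAdj x y (x′@(a ∷ b ∷ _ , ab , _) , y′@(ys@(_ ∷ _) , w′) , x′≈x , y′≈y , tail≡init , _) =
    a ∷ ys ,
    (subst (Arc* G a) (∷-injectiveˡ tail≡init) ab , w′) ,
    ≈S-trans (inj₁ (cong (a ∷_) (sym tail≡init))) (≈Q⇒≈S x′ x x′≈x) ,
    ≈Q⇒≈S y′ y y′≈y

  SAdj⇒QAdj : (x y : Walk G ℓ) → SAdjVia G (Arc* G) x y → QAdj G x y
  SAdj⇒QAdj x y (ws@(_ ∷ _) , w , init≈x , tail≈y) =
    x′ , y′ , ≈S⇒≈Q x′ x init≈x , ≈S⇒≈Q y′ y tail≈y , refl , IsWalk-lastStep ws w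
    where
    x′ y′ : Walk G _
    x′ = init ws , IsWalk-init ws w
    y′ = tail ws , IsWalk-tail ws w

  SAdjEdge⇒SAdj : (x y : Walk G ℓ) → SAdjVia G Edge x y → SAdjVia G (Arc* G) x y
  SAdjEdge⇒SAdj x y (ws , w , init≈x , tail≈y) = ws , IsWalk-map inj₁ ws w , init≈x , tail≈y

  SAdjEdge⇒QAdj : (x y : Walk G ℓ) → SAdjVia G Edge x y → QAdj G x y
  SAdjEdge⇒QAdj x y = SAdj⇒QAdj x y ∘ SAdjEdge⇒SAdj x y

  SAdjEdge-sym : (x y : Walk G (suc ℓ)) → SAdjVia G Edge y x → SAdjVia G Edge x y
  SAdjEdge-sym x y (ws , u , init≈y , tail≈x) =
    reverse ws , Undirected-reverse ws u ,
    ≈S-trans (inj₁ (init-reverse ws)) (≈S-trans (reverse-≈S (tail ws) (IsWalk-tail ws u)) tail≈x) ,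
    ≈S-trans (inj₁ tail-reverse) (≈S-trans (reverse-≈S (init ws) (IsWalk-init ws u)) init≈y)
    where
    tail-reverse : tail (reverse ws) ≡ reverse (init ws)
    tail-reverse = begin
      tail (reverse ws)                     ≡⟨ reverse-involutive (tail (reverse ws)) ⟨
      reverse (reverse (tail (reverse ws))) ≡⟨ cong reverse (init-reverse (reverse ws)) ⟨
      reverse (init (reverse (reverse ws))) ≡⟨ cong (λ vs → reverse (init vs)) (reverse-involutive ws) ⟩
      reverse (init ws)                     ∎
      where open ≡-Reasoning

  SAdj-both⇒SAdjEdge : (x y : Walk G (suc ℓ)) →
                       SAdjVia G (Arc* G) x y → SAdjVia G (Arc* G) y x → SAdjVia G Edge x y
  SAdj-both⇒SAdjEdge x y (ws , w , wx , wy) (zs@(_ ∷ _) , z , zy , zx)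
    with ≈S-trans zx (≈S-sym wx) | ≈S-trans zy (≈S-sym wy)
  ... | inj₁ tail≡init | inj₁ init≡tail =
    ws , periodic⇒undirected ws w (trans (cong tail (sym init≡tail)) (cong init tail≡init)) , wx , wy
  ... | inj₁ tail≡init | inj₂ (u , tail≡init⁻) =
    SAdjEdge-sym x y (zs , retraced⇒undirected zs ws z w u tail≡init⁻ (sym tail≡init) , zy , zx)
  ... | inj₂ (u , init≡tail⁻) | inj₁ init≡tail =
    ws , retraced⇒undirected ws zs w z (Undirected-conjugate init≡tail⁻ u)
                             (sym (reverse-reverse (sym init≡tail⁻))) init≡tail , wx , wy
  ... | inj₂ (u , init≡tail⁻) | inj₂ (u′ , tail≡init⁻) =
    ws , IsWalk-fromInitTail ws (Undirected-conjugate init≡tail⁻ u)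
                                (Undirected-conjugate tail≡init⁻ u′) , wx , wy

theorem3p3 : (G : MixedGraph) (ℓ : ℕ) → 1 ≤ ℓ →
    (x y : Walk G ℓ) →
      (_≈Q_ G x y ⇔ _≈S_ G (seq G x) (seq G y))
      × (QEdge G x y ⇔ SEdge G x y)
      × (QArc G x y ⇔ SArc G x y)
theorem3p3 G (suc ℓ) _ x y = ≈Q⇔≈S G x y , mk⇔ edge⇒ edge⇐ , mk⇔ arc⇒ arc⇐
  where
  edge⇒ : QEdge G x y → SEdge G x y
  edge⇒ (x≉y , xy , yx) =
    x≉y ∘ ≈S⇒≈Q G x y , SAdj-both⇒SAdjEdge G x y (QAdj⇒SAdj G x y xy) (QAdj⇒SAdj G y x yx)
  edge⇐ : SEdge G x y → QEdge G x y
  edge⇐ (x≉y , xy) =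
    x≉y ∘ ≈Q⇒≈S G x y , SAdjEdge⇒QAdj G x y xy , SAdjEdge⇒QAdj G y x (SAdjEdge-sym G y x xy)
  arc⇒ : QArc G x y → SArc G x y
  arc⇒ (x≉y , xy , ¬yx) =
    x≉y ∘ ≈S⇒≈Q G x y , QAdj⇒SAdj G x y xy , ¬yx ∘ SAdjEdge⇒QAdj G y x ∘ SAdjEdge-sym G y x
  arc⇐ : SArc G x y → QArc G x y
  arc⇐ (x≉y , xy , ¬xy) =
    x≉y ∘ ≈Q⇒≈S G x y , SAdj⇒QAdj G x y xy , ¬xy ∘ SAdj-both⇒SAdjEdge G x y xy ∘ QAdj⇒SAdj G y x
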